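{- Let $A$ be a $p$-semisimple pseudo-BCI algebra and let $\mathcal{IDOP}(A)$ be the set of all maps $A\to A$ that are both type I and type II implicative derivations. Then $(\mathcal{IDOP}(A),\circ,\mathrm{Id}_A)$ is a commutative monoid, where $\circ$ is composition of maps.
   Context: A pseudo-BCI algebra is a structure $(A,\to,\rightsquigarrow,1)$ of type $(2,2,0)$ such that for all $x,y,z\in A$: $(x\to y)\rightsquigarrow[(y\to z)\rightsquigarrow(x\to z)]=1$; $(x\rightsquigarrow y)\to[(y\rightsquigarrow z)\to(x\rightsquigarrow z)]=1$; $1\to x=x$; $1\rightsquigarrow x=x$; and $x\to y=1$, $y\to x=1$ imply $x=y$. Write $x\le y$ iff $x\to y=1$. $A$ is $p$-semisimple if $x\le 1$ implies $x=1$. Put $x\Cup_1 y=(x\to y)\rightsquigarrow y$ and $x\Cup_2 y=(x\rightsquigarrow y)\to y$. A map $d:A\to A$ is a type I implicative derivation if $d(x\to y)=(x\to d(y))\Cup_2(d(x)\to y)$ and $d(x\rightsquigarrow y)=(x\rightsquigarrow d(y))\Cup_1(d(x)\rightsquigarrow y)$ for all $x,y$; it is a type II implicative derivation if $d(x\to y)=(d(x)\to y)\Cup_2(x\to d(y))$ and $d(x\rightsquigarrow y)=(d(x)\rightsquigarrow y)\Cup_1(x\rightsquigarrow d(y))$ for all $x,y$. -}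

module Defs where

open import Level using (Level; _⊔_)
open import Data.Product using (Σ; _×_; _,_; proj₁)
open import Relation.Binary.PropositionalEquality using (_≡_)
open import Function using (_∘_; id)
open import Algebra.Structures using (IsCommutativeMonoid)

record IsPseudoBCI {a} (A : Set a) (_⇒_ _⇝_ : A → A → A) (𝟙 : A) : Set a where
  field
    ax1 : ∀ x y z → (x ⇒ y) ⇝ ((y ⇒ z) ⇝ (x ⇒ z)) ≡ 𝟙
    ax2 : ∀ x y z → (x ⇝ y) ⇒ ((y ⇝ z) ⇒ (x ⇝ z)) ≡ 𝟙
    ax3 : ∀ x → 𝟙 ⇒ x ≡ x
    ax4 : ∀ x → 𝟙 ⇝ x ≡ x
    ax5 : ∀ x y → x ⇒ y ≡ 𝟙 → y ⇒ x ≡ 𝟙 → x ≡ y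

record PseudoBCI a : Set (Level.suc a) where
  field
    Carrier : Set a
    _⇒_ : Carrier → Carrier → Carrier
    _⇝_ : Carrier → Carrier → Carrier
    𝟙 : Carrier
    isPseudoBCI : IsPseudoBCI Carrier _⇒_ _⇝_ 𝟙

  _≤_ : Carrier → Carrier → Set a
  x ≤ y = x ⇒ y ≡ 𝟙

  _⋓₁_ : Carrier → Carrier → Carrier
  x ⋓₁ y = (x ⇒ y) ⇝ y

  _⋓₂_ : Carrier → Carrier → Carrier
  x ⋓₂ y = (x ⇝ y) ⇒ y

module _ {a} (A : PseudoBCI a) where
  open PseudoBCI A

  IsPSemisimple : Set a
  IsPSemisimple = ∀ x → x ≤ 𝟙 → x ≡ 𝟙

  IsTypeIImplicativeDerivation : (Carrier → Carrier) → Set a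
  IsTypeIImplicativeDerivation d =
    (∀ x y → d (x ⇒ y) ≡ (x ⇒ d y) ⋓₂ (d x ⇒ y)) ×
    (∀ x y → d (x ⇝ y) ≡ (x ⇝ d y) ⋓₁ (d x ⇝ y))

  IsTypeIIImplicativeDerivation : (Carrier → Carrier) → Set a
  IsTypeIIImplicativeDerivation d =
    (∀ x y → d (x ⇒ y) ≡ (d x ⇒ y) ⋓₂ (x ⇒ d y)) ×
    (∀ x y → d (x ⇝ y) ≡ (d x ⇝ y) ⋓₁ (x ⇝ d y))

  IsIDOP : (Carrier → Carrier) → Set a
  IsIDOP d = IsTypeIImplicativeDerivation d × IsTypeIIImplicativeDerivation d

  IDOP : Set a
  IDOP = Σ (Carrier → Carrier) IsIDOP

  _≈ᴵ_ : IDOP → IDOP → Set a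
  (d , _) ≈ᴵ (e , _) = ∀ x → d x ≡ e x

  -- the monoid structure (∘, Id) on IDOP(A) exists provided IDOP is closed under ∘ and contains Id
  IDOP-∘ : (∀ d e → IsIDOP d → IsIDOP e → IsIDOP (d ∘ e)) → IDOP → IDOP → IDOP
  IDOP-∘ cl (d , pd) (e , pe) = (d ∘ e , cl d e pd pe)

  IDOP-id : IsIDOP id → IDOP
  IDOP-id p = (id , p)

-- In a p-semisimple pseudo-BCI algebra x ≤ y already forces x = y, so
-- (x ⇝ y) ⇒ y = x = (x ⇒ y) ⇝ y.  The derivation laws of both types therefore say
-- that d commutes with either implication in either argument.  Such maps are
-- closed under composition, and each is a translation d x = d 𝟙 ⇒ x = d 𝟙 ⇝ x;
-- two translations commute by the exchange law a ⇒ (b ⇝ x) = b ⇝ (a ⇒ x).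
module Submission where

open import Defs
open import Data.Product using (Σ; _,_)
open import Function using (_∘_; id)
open import Algebra.Structures using (IsCommutativeMonoid)
open import Relation.Binary.PropositionalEquality
open ≡-Reasoning

module PseudoBCIProperties {a} (A : PseudoBCI a) where
  open PseudoBCI A
  open IsPseudoBCI isPseudoBCI

  ⇒-refl : ∀ x → x ⇒ x ≡ 𝟙
  ⇒-refl x = begin
    x ⇒ x                              ≡˘⟨ cong₂ _⇒_ (ax4 x) (ax4 x) ⟩
    (𝟙 ⇝ x) ⇒ (𝟙 ⇝ x)                  ≡˘⟨ ax3 _ ⟩
    𝟙 ⇒ ((𝟙 ⇝ x) ⇒ (𝟙 ⇝ x))            ≡˘⟨ cong (_⇒ ((𝟙 ⇝ x) ⇒ (𝟙 ⇝ x))) (ax4 𝟙) ⟩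
    (𝟙 ⇝ 𝟙) ⇒ ((𝟙 ⇝ x) ⇒ (𝟙 ⇝ x))      ≡⟨ ax2 𝟙 𝟙 x ⟩
    𝟙                                  ∎

  x≤x⋓₂y : ∀ x y → x ≤ (x ⋓₂ y)
  x≤x⋓₂y x y = begin
    x ⇒ ((x ⇝ y) ⇒ y)                  ≡˘⟨ cong₂ (λ s t → s ⇒ ((x ⇝ y) ⇒ t)) (ax4 x) (ax4 y) ⟩
    (𝟙 ⇝ x) ⇒ ((x ⇝ y) ⇒ (𝟙 ⇝ y))      ≡⟨ ax2 𝟙 x y ⟩
    𝟙                                  ∎

  x⇝x⋓₁y≡𝟙 : ∀ x y → x ⇝ (x ⋓₁ y) ≡ 𝟙
  x⇝x⋓₁y≡𝟙 x y = begin
    x ⇝ ((x ⇒ y) ⇝ y)                  ≡˘⟨ cong₂ (λ s t → s ⇝ ((x ⇒ y) ⇝ t)) (ax3 x) (ax3 y) ⟩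
    (𝟙 ⇒ x) ⇝ ((x ⇒ y) ⇝ (𝟙 ⇒ y))      ≡⟨ ax1 𝟙 x y ⟩
    𝟙                                  ∎

  ⇝≡𝟙⇒≤ : ∀ {x y} → x ⇝ y ≡ 𝟙 → x ≤ y
  ⇝≡𝟙⇒≤ {x} {y} x⇝y≡𝟙 = begin
    x ⇒ y                              ≡˘⟨ cong (x ⇒_) (ax3 y) ⟩
    x ⇒ (𝟙 ⇒ y)                        ≡˘⟨ cong (λ t → x ⇒ (t ⇒ y)) x⇝y≡𝟙 ⟩
    x ⇒ ((x ⇝ y) ⇒ y)                  ≡⟨ x≤x⋓₂y x y ⟩
    𝟙                                  ∎

  ≤⇒converse≤𝟙 : ∀ {x y} → x ≤ y → (y ⇒ x) ≤ 𝟙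
  ≤⇒converse≤𝟙 {x} {y} x≤y = ⇝≡𝟙⇒≤ (begin
    (y ⇒ x) ⇝ 𝟙                        ≡˘⟨ cong ((y ⇒ x) ⇝_) (⇒-refl x) ⟩
    (y ⇒ x) ⇝ (x ⇒ x)                  ≡˘⟨ ax4 _ ⟩
    𝟙 ⇝ ((y ⇒ x) ⇝ (x ⇒ x))            ≡˘⟨ cong (_⇝ ((y ⇒ x) ⇝ (x ⇒ x))) x≤y ⟩
    (x ⇒ y) ⇝ ((y ⇒ x) ⇝ (x ⇒ x))      ≡⟨ ax1 x y x ⟩
    𝟙                                  ∎)

module PSemisimpleProperties {a} (A : PseudoBCI a) (pSemisimple : IsPSemisimple A) where
  open PseudoBCI A
  open IsPseudoBCI isPseudoBCI
  open PseudoBCIProperties A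

  ≤⇒≡ : ∀ {x y} → x ≤ y → x ≡ y
  ≤⇒≡ x≤y = ax5 _ _ x≤y (pSemisimple _ (≤⇒converse≤𝟙 x≤y))

  ⋓₂-absorb : ∀ x y → x ⋓₂ y ≡ x
  ⋓₂-absorb x y = sym (≤⇒≡ (x≤x⋓₂y x y))

  ⋓₁-absorb : ∀ x y → x ⋓₁ y ≡ x
  ⋓₁-absorb x y = sym (≤⇒≡ (⇝≡𝟙⇒≤ (x⇝x⋓₁y≡𝟙 x y)))

  ⇒-⇝-exchange : ∀ x y z → x ⇒ (y ⇝ z) ≡ y ⇝ (x ⇒ z)
  ⇒-⇝-exchange x y z = begin
    x ⇒ (y ⇝ z)                        ≡⟨ ≤⇒≡ (⇝≡𝟙⇒≤ (ax1 x (y ⇝ z) z)) ⟩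
    ((y ⇝ z) ⇒ z) ⇝ (x ⇒ z)            ≡⟨ cong (_⇝ (x ⇒ z)) (⋓₂-absorb y z) ⟩
    y ⇝ (x ⇒ z)                        ∎

  record CommutesWithImplications (d : Carrier → Carrier) : Set a where
    field
      ⇒-right : ∀ x y → d (x ⇒ y) ≡ x ⇒ d y
      ⇝-right : ∀ x y → d (x ⇝ y) ≡ x ⇝ d y
      ⇒-left  : ∀ x y → d (x ⇒ y) ≡ d x ⇒ y
      ⇝-left  : ∀ x y → d (x ⇝ y) ≡ d x ⇝ y

    ≡𝟙⇒ : ∀ x → d x ≡ d 𝟙 ⇒ x
    ≡𝟙⇒ x = trans (cong d (sym (ax3 x))) (⇒-left 𝟙 x)

    ≡𝟙⇝ : ∀ x → d x ≡ d 𝟙 ⇝ x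
    ≡𝟙⇝ x = trans (cong d (sym (ax4 x))) (⇝-left 𝟙 x)

  open CommutesWithImplications

  IsIDOP⇒commutes : ∀ {d} → IsIDOP A d → CommutesWithImplications d
  IsIDOP⇒commutes ((I⇒ , I⇝) , (II⇒ , II⇝)) = record
    { ⇒-right = λ x y → trans (I⇒ x y) (⋓₂-absorb _ _)
    ; ⇝-right = λ x y → trans (I⇝ x y) (⋓₁-absorb _ _)
    ; ⇒-left  = λ x y → trans (II⇒ x y) (⋓₂-absorb _ _)
    ; ⇝-left  = λ x y → trans (II⇝ x y) (⋓₁-absorb _ _)
    }

  commutes⇒IsIDOP : ∀ {d} → CommutesWithImplications d → IsIDOP A d
  commutes⇒IsIDOP D =
    ( (λ x y → trans (⇒-right D x y) (sym (⋓₂-absorb _ _)))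
    , (λ x y → trans (⇝-right D x y) (sym (⋓₁-absorb _ _))))
    , ( (λ x y → trans (⇒-left D x y) (sym (⋓₂-absorb _ _)))
      , (λ x y → trans (⇝-left D x y) (sym (⋓₁-absorb _ _))))

  id-commutes : CommutesWithImplications id
  id-commutes = record
    { ⇒-right = λ _ _ → refl ; ⇝-right = λ _ _ → refl
    ; ⇒-left  = λ _ _ → refl ; ⇝-left  = λ _ _ → refl }

  ∘-commutes : ∀ {d e} → CommutesWithImplications d → CommutesWithImplications e →
               CommutesWithImplications (d ∘ e)
  ∘-commutes {d} {e} D E = record
    { ⇒-right = λ x y → trans (cong d (⇒-right E x y)) (⇒-right D x (e y))
    ; ⇝-right = λ x y → trans (cong d (⇝-right E x y)) (⇝-right D x (e y))
    ; ⇒-left  = λ x y → trans (cong d (⇒-left E x y)) (⇒-left D (e x) y)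
    ; ⇝-left  = λ x y → trans (cong d (⇝-left E x y)) (⇝-left D (e x) y)
    }

  commuting-maps-commute : ∀ {d e} → CommutesWithImplications d → CommutesWithImplications e →
                           ∀ x → d (e x) ≡ e (d x)
  commuting-maps-commute {d} {e} D E x = begin
    d (e x)                            ≡⟨ cong d (≡𝟙⇒ E x) ⟩
    d (e 𝟙 ⇒ x)                        ≡⟨ ⇒-right D (e 𝟙) x ⟩
    e 𝟙 ⇒ d x                          ≡⟨ cong (e 𝟙 ⇒_) (≡𝟙⇝ D x) ⟩
    e 𝟙 ⇒ (d 𝟙 ⇝ x)                    ≡⟨ ⇒-⇝-exchange (e 𝟙) (d 𝟙) x ⟩
    d 𝟙 ⇝ (e 𝟙 ⇒ x)                    ≡˘⟨ cong (d 𝟙 ⇝_) (≡𝟙⇒ E x) ⟩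
    d 𝟙 ⇝ e x                          ≡˘⟨ ⇝-right E (d 𝟙) x ⟩
    e (d 𝟙 ⇝ x)                        ≡˘⟨ cong e (≡𝟙⇝ D x) ⟩
    e (d x)                            ∎

  IDOP-∘-closed : ∀ d e → IsIDOP A d → IsIDOP A e → IsIDOP A (d ∘ e)
  IDOP-∘-closed d e d∈ e∈ = commutes⇒IsIDOP (∘-commutes (IsIDOP⇒commutes d∈) (IsIDOP⇒commutes e∈))

  id∈IDOP : IsIDOP A id
  id∈IDOP = commutes⇒IsIDOP id-commutes

  IDOP-isCommutativeMonoid : IsCommutativeMonoid (_≈ᴵ_ A) (IDOP-∘ A IDOP-∘-closed) (IDOP-id A id∈IDOP)
  IDOP-isCommutativeMonoid = record
    { isMonoid = record
      { isSemigroup = record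
        { isMagma = record
          { isEquivalence = record
            { refl  = λ _ → refl
            ; sym   = λ d≈e x → sym (d≈e x)
            ; trans = λ d≈e e≈f x → trans (d≈e x) (e≈f x)
            }
          ; ∙-cong = λ { {d , _} {_} {_} {e′ , _} d≈d′ e≈e′ x → trans (cong d (e≈e′ x)) (d≈d′ (e′ x)) }
          }
        ; assoc = λ _ _ _ _ → refl
        }
      ; identity = (λ _ _ → refl) , (λ _ _ → refl)
      }
    ; comm = λ { (d , d∈) (e , e∈) →
        commuting-maps-commute (IsIDOP⇒commutes d∈) (IsIDOP⇒commutes e∈) }
    }

theorem4p10 : ∀ {a} (A : PseudoBCI a) → IsPSemisimple A →
    Σ (∀ d e → IsIDOP A d → IsIDOP A e → IsIDOP A (d ∘ e)) λ closed →
    Σ (IsIDOP A id) λ idIn →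
      IsCommutativeMonoid (_≈ᴵ_ A) (IDOP-∘ A closed) (IDOP-id A idIn)
theorem4p10 A pSemisimple = IDOP-∘-closed , id∈IDOP , IDOP-isCommutativeMonoid
  where open PSemisimpleProperties A pSemisimple
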